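{- Let $T$ be a tree with $n$ vertices, $w\colon V(T)\to\mathbb{Z}_{>0}$ a positive integral weight function, and $M$ a positive integer with $M\ge n$. Then $$M\cdot \mathrm{td}(T,w) \le \mathrm{MinHLT}(G_M(T,w)) \le M\cdot \mathrm{td}(T,w) + n^2.$$
   Context: A treedepth decomposition of a graph $G$ is a rooted forest $F$ with $V(F)=V(G)$ such that for every edge $uv\in E(G)$, $u$ is an ancestor of $v$ in $F$ or vice versa. For a graph $G$ with vertex weights $w$, $\mathrm{td}(G,w)$ is the minimum integer $k$ such that there is a treedepth decomposition of $G$ in which, on every vertical path (path of pairwise ancestor-comparable vertices), the sum of weights of the vertices is at most $k$. For a tree $T$ with weights $w$ and a positive integer $M$, the graph $G_M(T,w)$ is constructed as follows: for each $x\in V(T)$ create a set $V_x$ of $w(x)\cdot M$ vertices forming a clique, and for each edge $xy\in E(T)$ add all edges between $V_x$ and $V_y$. A DFS tree of a connected graph $G$ is a spanning tree of $G$ with a root such that for every edge $uv\in E(G)$, $u$ and $v$ are in an ancestor–descendant relationship; the height of a rooted tree is the number of vertices on a longest root-to-leaf path. $\mathrm{MinHLT}(G)$ denotes the minimum height of a DFS tree of $G$. -}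

module Defs where

open import Data.Nat using (ℕ; zero; suc; _+_; _*_; _≤_)
open import Data.Fin using (Fin)
open import Data.List using (List; []; _∷_; length; map)
open import Data.Nat.ListAction using (sum)
open import Data.List.Relation.Unary.AllPairs using (AllPairs)
open import Data.List.Relation.Unary.All using (All)
open import Data.Maybe using (Maybe; just; nothing)
open import Data.Product using (Σ; ∃; _×_; _,_)
open import Data.Sum using (_⊎_)
open import Relation.Nullary using (¬_)
open import Relation.Binary.PropositionalEquality using (_≡_; _≢_; refl) renaming (sym to ≡-sym)
import Data.Sum as S

record Graph (V : Set) : Set₁ where
  field
    E     : V → V → Set
    E-sym : ∀ {u v} → E u v → E v u
    irrefl : ∀ {v} → ¬ E v v
open Graph public

data Walk {V : Set} (G : Graph V) : V → V → Set where
  here : ∀ {v} → Walk G v v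
  step : ∀ {u w v} → E G u w → Walk G w v → Walk G u v

Connected : {V : Set} → Graph V → Set
Connected {V} G = V × (∀ u v → Walk G u v)   -- nonempty and connected

data IsPath {V : Set} (G : Graph V) : List V → Set where
  p-one  : ∀ {v} → IsPath G (v ∷ [])
  p-cons : ∀ {u v xs} → E G u v → IsPath G (v ∷ xs) → IsPath G (u ∷ v ∷ xs)

data Last {V : Set} : List V → V → Set where
  last-one  : ∀ {v} → Last (v ∷ []) v
  last-cons : ∀ {u xs v} → Last xs v → Last (u ∷ xs) v

HasCycle : {V : Set} → Graph V → Set
HasCycle {V} G =
  Σ V λ v₀ → Σ (List V) λ rest → Σ V λ vₖ →
    (3 ≤ suc (length rest)) × AllPairs _≢_ (v₀ ∷ rest) × IsPath G (v₀ ∷ rest)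
    × Last (v₀ ∷ rest) vₖ × E G vₖ v₀

IsTree : {V : Set} → Graph V → Set
IsTree G = Connected G × ¬ HasCycle G

record RootedForest (V : Set) : Set where
  field
    parent : V → Maybe V
open RootedForest public

data Anc {V : Set} (F : RootedForest V) : V → V → Set where
  anc-refl : ∀ {v} → Anc F v v
  anc-step : ∀ {u v p} → parent F v ≡ just p → Anc F u p → Anc F u v

SAnc : {V : Set} → RootedForest V → V → V → Set
SAnc F u v = Σ _ λ p → parent F v ≡ just p × Anc F u p

IsForest : {V : Set} → RootedForest V → Set
IsForest {V} F = ∀ (v : V) → ¬ SAnc F v v

Comparable : {V : Set} → RootedForest V → V → V → Set
Comparable F u v = Anc F u v ⊎ Anc F v u

VerticalPath : {V : Set} → RootedForest V → List V → Set
VerticalPath F xs = AllPairs _≢_ xs × AllPairs (Comparable F) xs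

IsTDDecomp : {V : Set} → Graph V → RootedForest V → Set
IsTDDecomp {V} G F = IsForest F × (∀ (u v : V) → E G u v → Comparable F u v)

WeightBound : {V : Set} → RootedForest V → (V → ℕ) → ℕ → Set
WeightBound {V} F w k = ∀ (xs : List V) → VerticalPath F xs → sum (map w xs) ≤ k

IsTd : {V : Set} → Graph V → (V → ℕ) → ℕ → Set
IsTd {V} G w k =
  (Σ (RootedForest V) λ F → IsTDDecomp G F × WeightBound F w k)
  × (∀ k' (F : RootedForest V) → IsTDDecomp G F → WeightBound F w k' → k ≤ k')

data RootPath {V : Set} (F : RootedForest V) : V → List V → Set where
  rp-root : ∀ {v} → parent F v ≡ nothing → RootPath F v (v ∷ [])
  rp-step : ∀ {v p xs} → parent F v ≡ just p → RootPath F p xs → RootPath F v (v ∷ xs)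

-- height (number of vertices on a longest root-to-leaf path) is at most h
HeightAtMost : {V : Set} → RootedForest V → ℕ → Set
HeightAtMost {V} F h = ∀ (v : V) (xs : List V) → RootPath F v xs → length xs ≤ h

IsRoot : {V : Set} → RootedForest V → V → Set
IsRoot F r = parent F r ≡ nothing

IsDFSTree : {V : Set} → Graph V → RootedForest V → Set
IsDFSTree {V} G F =
  IsForest F
  × (Σ V λ r → IsRoot F r × (∀ r' → IsRoot F r' → r' ≡ r))
  × (∀ (v p : V) → parent F v ≡ just p → E G v p)
  × (∀ (u v : V) → E G u v → Comparable F u v)

IsMinHLT : {V : Set} → Graph V → ℕ → Set
IsMinHLT {V} G h =
  (Σ (RootedForest V) λ F → IsDFSTree G F × HeightAtMost F h)
  × (∀ h' (F : RootedForest V) → IsDFSTree G F → HeightAtMost F h' → h ≤ h')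

GMV : {n : ℕ} → (Fin n → ℕ) → ℕ → Set
GMV {n} w M = Σ (Fin n) λ x → Fin (w x * M)

GM-E : {n : ℕ} → Graph (Fin n) → (w : Fin n → ℕ) → (M : ℕ) → GMV w M → GMV w M → Set
GM-E T w M (x , i) (y , j) = (x ≡ y × (x , i) ≢ (y , j)) ⊎ E T x y

GM-sym : ∀ {n} (T : Graph (Fin n)) w M {u v} → GM-E T w M u v → GM-E T w M v u
GM-sym T w M (S.inj₁ (refl , ne)) = S.inj₁ (refl , λ eq → ne (≡-sym eq))
GM-sym T w M (S.inj₂ e) = S.inj₂ (E-sym T e)

GM-irr : ∀ {n} (T : Graph (Fin n)) w M {v} → ¬ GM-E T w M v v
GM-irr T w M (S.inj₁ (_ , ne)) = ne refl
GM-irr T w M (S.inj₂ e) = irrefl T e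

GM : {n : ℕ} → Graph (Fin n) → (w : Fin n → ℕ) → (M : ℕ) → Graph (GMV w M)
GM T w M = record { E = GM-E T w M ; E-sym = GM-sym T w M ; irrefl = GM-irr T w M }

-- Every class V_x of G_M(T,w) is a clique, hence a chain in any treedepth
-- decomposition of G_M(T,w).  Restricting such a forest to the deepest vertex of each class
-- gives a treedepth decomposition of T, and the classes of a vertical path of it all lie on
-- the root path of one vertex; so the height is at least M times the weight of the path.
--
-- Rank the vertices of T by depth in an optimal decomposition F.  The elimination
-- forest of this ranking is a single tree whose ancestry refines that of F, and every vertex x
-- reaches a neighbour of its parent by a path in T through descendants of x.  Replacing x by a
-- chain (one reserved copy of each vertex of that path, possible because M ≥ n, followed by the
-- rest of V_x) yields a DFS tree of G_M(T,w).  A root path meets the chains of a vertical path of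
-- F, each of at most n + M·w(x) vertices, and there are at most n of them.

module Submission where

open import Defs
open import Data.Nat using (ℕ; zero; suc; _+_; _*_; _≤_; _<_; z≤n; s≤s; _≤?_; _<?_; _/_; NonZero; >-nonZero) renaming (_≟_ to _≟ℕ_)
open import Data.Nat.Properties hiding (_≟_)
open import Data.Nat.DivMod using (m*n/n≡m; m/n*n≤m; /-monoˡ-≤)
open import Data.Nat.ListAction using (sum)
open import Data.Nat.Tactic.RingSolver using (solve-∀)
open import Data.Fin using (Fin; toℕ; fromℕ<)
import Data.Fin.Properties as Fin
open import Data.List using (List; []; _∷_; length; map; _++_; allFin; filter; concatMap; tabulate)
open import Data.List.Extrema.Nat using (argmax; argmin; argmax-all; f[⊥]≤f[argmax]; f[xs]≤f[argmax]; f[argmin]≤f[xs])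
open import Data.List.Relation.Unary.All.Properties using (all-filter)
open import Data.List.Properties using (length-++; length-map; length-filter; length-tabulate; length-removeAt′)
open import Data.List.Membership.Propositional using (_∈_; _∉_; lose; find)
open import Data.List.Membership.Propositional.Properties
  using (∈-allFin; ∈-map⁺; ∈-map⁻; ∈-++⁺ˡ; ∈-++⁺ʳ; ∈-++⁻; ∈-filter⁺; ∈-filter⁻; ∈-concatMap⁺; ∈-concatMap⁻; ∈-tabulate⁺; ∈-tabulate⁻)
import Data.List.Membership.DecPropositional as DecMembership
open import Data.List.Relation.Binary.Subset.Propositional using (_⊆_)
open import Data.List.Relation.Unary.Any using (here; there; index; _─_)
open import Data.List.Relation.Unary.All using (All; []; _∷_)
import Data.List.Relation.Unary.All as All
open import Data.List.Relation.Unary.AllPairs using (AllPairs; []; _∷_)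
import Data.List.Relation.Unary.AllPairs as AllPairs
import Data.List.Relation.Unary.AllPairs.Properties as AllPairs
open import Data.List.Relation.Unary.Unique.Propositional using (Unique)
import Data.List.Relation.Unary.Unique.Propositional.Properties as Unique
open import Data.Maybe using (Maybe; just; nothing; _<∣>_)
import Data.Maybe as Maybe
open import Data.Maybe.Properties using (just-injective)
open import Data.Product using (Σ; ∃; _×_; _,_; proj₁; proj₂)
open import Data.Product.Properties using (≡-dec; ,-injectiveˡ)
open import Data.Sum using (_⊎_; inj₁; inj₂)
import Data.Sum
open import Data.Empty using (⊥-elim)
open import Relation.Nullary using (¬_; Dec; yes; no; ¬?)
open import Relation.Nullary.Decidable using (_×-dec_)
open import Function using (case_of_; _∘_)
open import Induction.WellFounded using (Acc; acc)
open import Data.Nat.Induction using (<-wellFounded)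
open import Relation.Binary.Definitions using (DecidableEquality; tri<; tri≈; tri>)
open import Relation.Binary.PropositionalEquality
  using (_≡_; _≢_; refl; sym; trans; cong; cong₂; subst; module ≡-Reasoning)

private
  variable
    A V X : Set

Enumeration : Set → Set
Enumeration A = Σ (List A) λ xs → ∀ x → x ∈ xs

∈-─ : ∀ {x z : A} {ys} (x∈ys : x ∈ ys) → z ∈ ys → z ≢ x → z ∈ (ys ─ x∈ys)
∈-─ (here refl) (here refl) z≢x = ⊥-elim (z≢x refl)
∈-─ (here refl) (there z∈ys) _ = z∈ys
∈-─ (there x∈ys) (here refl) _ = here refl
∈-─ (there x∈ys) (there z∈ys) z≢x = there (∈-─ x∈ys z∈ys z≢x)

unique-⊆⇒length≤ : ∀ {xs ys : List A} → Unique xs → xs ⊆ ys → length xs ≤ length ys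
unique-⊆⇒length≤ {xs = []} _ _ = z≤n
unique-⊆⇒length≤ {xs = x ∷ xs} {ys} (x∉xs ∷ u) xs⊆ys = begin
  suc (length xs)       ≤⟨ s≤s (unique-⊆⇒length≤ u λ z∈xs →
                             ∈-─ x∈ys (xs⊆ys (there z∈xs)) λ z≡x → All.lookup x∉xs z∈xs (sym z≡x)) ⟩
  suc (length (ys ─ x∈ys)) ≡⟨ sym (length-removeAt′ ys (index x∈ys)) ⟩
  length ys             ∎
  where
  open ≤-Reasoning
  x∈ys = xs⊆ys (here refl)

unique⇒length≤size : ((all , _) : Enumeration A) → {xs : List A} → Unique xs → length xs ≤ length all
unique⇒length≤size (all , ∈all) u = unique-⊆⇒length≤ u λ {x} _ → ∈all x

enumerateFin : ∀ n → Enumeration (Fin n)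
enumerateFin n = allFin n , ∈-allFin

unique⇒length≤n : ∀ {n} {xs : List (Fin n)} → Unique xs → length xs ≤ n
unique⇒length≤n {n} {xs} u =
  subst (length xs ≤_) (length-tabulate {n = n} λ i → i) (unique⇒length≤size (enumerateFin n) u)

length-concatMap : (f : A → List V) (xs : List A) → length (concatMap f xs) ≡ sum (map (length ∘ f) xs)
length-concatMap f [] = refl
length-concatMap f (x ∷ xs) = trans (length-++ (f x)) (cong (length (f x) +_) (length-concatMap f xs))

last-∈ : ∀ {L : List A} {v} → Last L v → v ∈ L
last-∈ last-one = here refl
last-∈ (last-cons l) = there (last-∈ l)

last-unique : ∀ {L : List A} {u v} → Last L u → Last L v → u ≡ v
last-unique last-one last-one = refl
last-unique last-one (last-cons ())
last-unique (last-cons ()) last-one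
last-unique (last-cons l) (last-cons l′) = last-unique l l′

last-map : ∀ {B : Set} (f : A → B) {L u} → Last L u → Last (map f L) (f u)
last-map f last-one = last-one
last-map f (last-cons l) = last-cons (last-map f l)

last-++⁻ : ∀ (a : A) xs {ys v} → Last (a ∷ xs ++ ys) v → Last (a ∷ xs) v ⊎ v ∈ ys
last-++⁻ a [] {[]} last-one = inj₁ last-one
last-++⁻ a [] {_ ∷ _} (last-cons l) = inj₂ (last-∈ l)
last-++⁻ a (b ∷ xs) (last-cons l) with last-++⁻ b xs l
... | inj₁ l′ = inj₁ (last-cons l′)
... | inj₂ v∈ys = inj₂ v∈ys

-- Rooted forests

module _ {F : RootedForest V} where

  anc-trans : ∀ {a b c} → Anc F a b → Anc F b c → Anc F a c
  anc-trans a≼b anc-refl = a≼b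
  anc-trans a≼b (anc-step e b≼p) = anc-step e (anc-trans a≼b b≼p)

  sanc⇒anc : ∀ {u v} → SAnc F u v → Anc F u v
  sanc⇒anc (_ , e , u≼p) = anc-step e u≼p

  sanc-anc-trans : ∀ {a b c} → SAnc F a b → Anc F b c → SAnc F a c
  sanc-anc-trans (p , e , a≼p) anc-refl = p , e , a≼p
  sanc-anc-trans a<b (anc-step e b≼p) = _ , e , anc-trans (sanc⇒anc a<b) b≼p

  anc-≢⇒sanc : ∀ {u v} → Anc F u v → u ≢ v → SAnc F u v
  anc-≢⇒sanc anc-refl u≢u = ⊥-elim (u≢u refl)
  anc-≢⇒sanc (anc-step e u≼p) _ = _ , e , u≼p

  ancestors-comparable : ∀ {a b v} → Anc F a v → Anc F b v → Comparable F a b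
  ancestors-comparable anc-refl b≼v = inj₂ b≼v
  ancestors-comparable (anc-step e a≼p) anc-refl = inj₁ (anc-step e a≼p)
  ancestors-comparable (anc-step e a≼p) (anc-step e′ b≼p′) with trans (sym e) e′
  ... | refl = ancestors-comparable a≼p b≼p′

  ancestors-pairwiseComparable : ∀ {v} {xs : List V} → (∀ {a} → a ∈ xs → Anc F a v) → AllPairs (Comparable F) xs
  ancestors-pairwiseComparable {xs = []} _ = []
  ancestors-pairwiseComparable {xs = a ∷ xs} anc =
    All.tabulate (λ b∈xs → ancestors-comparable (anc (here refl)) (anc (there b∈xs)))
    ∷ ancestors-pairwiseComparable (λ b∈xs → anc (there b∈xs))

  deepest : ∀ xs {a} → a ∈ xs → AllPairs (Comparable F) xs → ∃ λ d → d ∈ xs × (∀ {x} → x ∈ xs → Anc F x d)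
  deepest (a ∷ []) _ _ = a , here refl , λ { (here refl) → anc-refl }
  deepest (a ∷ b ∷ xs) _ (a~xs ∷ b~xs) with deepest (b ∷ xs) (here refl) b~xs
  ... | d , d∈ , below-d with All.lookup a~xs d∈
  ...   | inj₁ a≼d = d , there d∈ , λ { (here refl) → a≼d ; (there x∈) → below-d x∈ }
  ...   | inj₂ d≼a = a , here refl , λ { (here refl) → anc-refl ; (there x∈) → anc-trans (below-d x∈) d≼a }

  data Climb : V → List V → Set where
    climb-stop : ∀ {v} → Climb v (v ∷ [])
    climb-up   : ∀ {v p xs} → parent F v ≡ just p → Climb p xs → Climb v (v ∷ xs)

  climb-anc : ∀ {u v xs} → Climb v xs → u ∈ xs → Anc F u v
  climb-anc climb-stop     (here refl)  = anc-refl
  climb-anc (climb-up e c) (here refl)  = anc-refl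
  climb-anc (climb-up e c) (there u∈xs) = anc-step e (climb-anc c u∈xs)

  climb-unique : IsForest F → ∀ {v xs} → Climb v xs → Unique xs
  climb-unique isF climb-stop = [] ∷ []
  climb-unique isF {v} (climb-up e c) =
    All.tabulate (λ u∈xs v≡u → isF v (_ , e , subst (λ z → Anc F z _) (sym v≡u) (climb-anc c u∈xs)))
    ∷ climb-unique isF c

  rootPath⇒climb : ∀ {v xs} → RootPath F v xs → Climb v xs
  rootPath⇒climb (rp-root _)   = climb-stop
  rootPath⇒climb (rp-step e r) = climb-up e (rootPath⇒climb r)

  rootPath-anc : ∀ {u v xs} → RootPath F v xs → u ∈ xs → Anc F u v
  rootPath-anc r = climb-anc (rootPath⇒climb r)

  rootPath-unique : IsForest F → ∀ {v xs} → RootPath F v xs → Unique xs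
  rootPath-unique isF r = climb-unique isF (rootPath⇒climb r)

  anc⇒∈rootPath : ∀ {u v xs} → RootPath F v xs → Anc F u v → u ∈ xs
  anc⇒∈rootPath (rp-root _)   anc-refl = here refl
  anc⇒∈rootPath (rp-step _ _) anc-refl = here refl
  anc⇒∈rootPath (rp-root e) (anc-step e′ _) with trans (sym e) e′
  ... | ()
  anc⇒∈rootPath (rp-step e r) (anc-step e′ u≼p) with trans (sym e) e′
  ... | refl = there (anc⇒∈rootPath r u≼p)

  rootPath-deterministic : ∀ {v xs ys} → RootPath F v xs → RootPath F v ys → xs ≡ ys
  rootPath-deterministic (rp-root _) (rp-root _) = refl
  rootPath-deterministic (rp-root e) (rp-step e′ _) with trans (sym e) e′
  ... | ()
  rootPath-deterministic (rp-step e _) (rp-root e′) with trans (sym e) e′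
  ... | ()
  rootPath-deterministic (rp-step e r) (rp-step e′ r′) with trans (sym e) e′
  ... | refl = cong (_ ∷_) (rootPath-deterministic r r′)

  climbFor : ∀ k v → (∃ λ xs → RootPath F v xs) ⊎ (∃ λ xs → Climb v xs × length xs ≡ suc k)
  climbFor zero v = inj₂ (_ , climb-stop , refl)
  climbFor (suc k) v with parent F v in e
  ... | nothing = inj₁ (_ , rp-root e)
  ... | just p with climbFor k p
  ...   | inj₁ (_ , r) = inj₁ (_ , rp-step e r)
  ...   | inj₂ (_ , c , len) = inj₂ (_ , climb-up e c , cong suc len)

  rootPath-exists : IsForest F → Enumeration V → ∀ v → ∃ λ xs → RootPath F v xs
  rootPath-exists isF enum@(all , _) v with climbFor (length all) v
  ... | inj₁ r = r
  ... | inj₂ (xs , c , len) =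
    ⊥-elim (<-irrefl refl (subst (_≤ length all) len (unique⇒length≤size enum (climb-unique isF c))))

-- Walks

data WalkThrough (G : Graph V) : V → V → List V → Set where
  wt-stop : ∀ {x} → WalkThrough G x x (x ∷ [])
  wt-step : ∀ {x z y xs} → E G x z → WalkThrough G z y xs → WalkThrough G x y (x ∷ xs)

ReachWithin : (G : Graph V) → (V → Set) → V → V → Set
ReachWithin G P a b = ∃ λ xs → WalkThrough G a b xs × All P xs

module _ {G : Graph V} where

  walk⇒walkThrough : ∀ {x y} → Walk G x y → ∃ (WalkThrough G x y)
  walk⇒walkThrough here = _ , wt-stop
  walk⇒walkThrough (step e w) = _ , wt-step e (proj₂ (walk⇒walkThrough w))

  walkThrough-start : ∀ {x y xs} → WalkThrough G x y xs → ∃ λ ys → xs ≡ x ∷ ys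
  walkThrough-start wt-stop = _ , refl
  walkThrough-start (wt-step _ _) = _ , refl

  walkThrough-end : ∀ {x y xs} → WalkThrough G x y xs → y ∈ xs
  walkThrough-end wt-stop = here refl
  walkThrough-end (wt-step _ w) = there (walkThrough-end w)

  walkThrough-isPath : ∀ {x y xs} → WalkThrough G x y xs → IsPath G xs
  walkThrough-isPath wt-stop = p-one
  walkThrough-isPath (wt-step e wt-stop) = p-cons e p-one
  walkThrough-isPath (wt-step e w@(wt-step _ _)) = p-cons e (walkThrough-isPath w)

  walkThrough-last : ∀ {x y xs} → WalkThrough G x y xs → Last xs y
  walkThrough-last wt-stop = last-one
  walkThrough-last (wt-step _ w) = last-cons (walkThrough-last w)

  walkThrough-suffix : ∀ {x z y ys} → WalkThrough G z y ys → x ∈ ys →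
                       ∃ λ zs → WalkThrough G x y zs × zs ⊆ ys × (Unique ys → Unique zs)
  walkThrough-suffix w (here refl) with walkThrough-start w
  ... | _ , refl = _ , w , (λ u∈ → u∈) , (λ u → u)
  walkThrough-suffix (wt-step _ w) (there x∈ys) with walkThrough-suffix w x∈ys
  ... | zs , w′ , zs⊆ys , uniq = zs , w′ , (λ u∈ → there (zs⊆ys u∈)) , λ { (_ ∷ u) → uniq u }

  shortcut : DecidableEquality V → ∀ {x y xs} → WalkThrough G x y xs →
             ∃ λ ys → WalkThrough G x y ys × Unique ys × ys ⊆ xs
  shortcut _≟_ wt-stop = _ , wt-stop , [] ∷ [] , (λ u∈ → u∈)
  shortcut _≟_ {x} (wt-step e w) with shortcut _≟_ w
  ... | ys , w′ , u , ys⊆xs with DecMembership._∈?_ _≟_ x ys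
  ...   | yes x∈ys = let zs , w″ , zs⊆ys , uniq = walkThrough-suffix w′ x∈ys in
                     zs , w″ , uniq u , (λ u∈ → there (ys⊆xs (zs⊆ys u∈)))
  ...   | no x∉ys = x ∷ ys , wt-step e w′ , All.tabulate (λ u∈ys x≡u → x∉ys (subst (_∈ ys) (sym x≡u) u∈ys)) ∷ u
                  , λ { (here refl) → here refl ; (there u∈) → there (ys⊆xs u∈) }

  module _ {P : V → Set} where

    reach-refl : ∀ {a} → P a → ReachWithin G P a a
    reach-refl pa = _ , wt-stop , pa ∷ []

    reach-step : ∀ {a b c} → P a → E G a b → ReachWithin G P b c → ReachWithin G P a c
    reach-step pa e (_ , w , ps) = _ , wt-step e w , pa ∷ ps

    reach-start : ∀ {a b} → ReachWithin G P a b → P a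
    reach-start (_ , w , ps) with walkThrough-start w
    ... | _ , refl = All.head ps

    reach-trans : ∀ {a b c} → ReachWithin G P a b → ReachWithin G P b c → ReachWithin G P a c
    reach-trans (_ , wt-stop , _) r = r
    reach-trans (_ , wt-step e w , pa ∷ ps) r = reach-step pa e (reach-trans (_ , w , ps) r)

    reach-sym : ∀ {a b} → ReachWithin G P a b → ReachWithin G P b a
    reach-sym (_ , wt-stop , ps) = _ , wt-stop , ps
    reach-sym (_ , wt-step e w , pa ∷ ps) =
      reach-trans (reach-sym (_ , w , ps)) (reach-step (reach-start (_ , w , ps)) (E-sym G e) (reach-refl pa))

  reach-exit : ∀ {P S : V → Set} → (∀ z → Dec (S z)) → ∀ {a b} → S a → ¬ S b → ReachWithin G P a b →
               ∃ λ c → ∃ λ q → S c × E G c q × ¬ S q × ReachWithin G P q b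
  reach-exit {P = P} {S} S? {b = b} sa ¬sb (_ , w , ps) = exit sa w ps
    where
    exit : ∀ {a xs} → S a → WalkThrough G a b xs → All P xs →
           ∃ λ c → ∃ λ q → S c × E G c q × ¬ S q × ReachWithin G P q b
    exit sa wt-stop _ = ⊥-elim (¬sb sa)
    exit {a} sa (wt-step {z = z} e w) (_ ∷ ps) with S? z
    ... | yes sz = exit sz w ps
    ... | no ¬sz = a , z , sa , e , ¬sz , (_ , w , ps)

  reach-from : ∀ {P : V → Set} {a b z xs} → WalkThrough G a b xs → All P xs → z ∈ xs → ReachWithin G P z b
  reach-from w ps z∈xs with walkThrough-suffix w z∈xs
  ... | zs , w′ , zs⊆xs , _ = zs , w′ , All.tabulate (λ u∈zs → All.lookup ps (zs⊆xs u∈zs))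

  reach-mono : ∀ {P Q : V → Set} {a b} → (∀ {z} → P z → Q z) → ReachWithin G P a b → ReachWithin G Q a b
  reach-mono P⇒Q (xs , w , ps) = xs , w , All.map P⇒Q ps

tree-adjacent? : {G : Graph V} → DecidableEquality V → IsTree G → ∀ x y → Dec (E G x y)
tree-adjacent? {G = G} _≟_ ((_ , connected) , acyclic) x y
  with shortcut _≟_ (proj₂ (walk⇒walkThrough (connected x y)))
... | _ , wt-stop , _ = no (irrefl G)
... | _ , wt-step e wt-stop , _ = yes e
... | _ , w@(wt-step {xs = rest} _ (wt-step _ w′)) , u , _ with walkThrough-start w′
...   | _ , refl = no λ x~y → acyclic
        (x , rest , y , s≤s (s≤s (s≤s z≤n)) , u , walkThrough-isPath w , walkThrough-last w , E-sym G x~y)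

module _ {n} {G : Graph (Fin n)} (E? : ∀ x y → Dec (E G x y)) {P : Fin n → Set} (P? : ∀ z → Dec (P z)) where

  private
    ReachIn : ℕ → Fin n → Fin n → Set
    ReachIn k z y = ∃ λ xs → WalkThrough G z y xs × All P xs × length xs ≤ suc k

    reachIn? : ∀ k z y → Dec (ReachIn k z y)
    reachIn? k z y with P? z
    ... | no ¬pz = no λ (_ , w , ps , _) → ¬pz (reach-start (_ , w , ps))
    reachIn? zero z y | yes pz with z Fin.≟ y
    ... | yes refl = yes (_ , wt-stop , pz ∷ [] , s≤s z≤n)
    ... | no z≢y = no λ { (_ , wt-stop , _) → z≢y refl
                        ; (_ , wt-step _ wt-stop , _ , s≤s ())
                        ; (_ , wt-step _ (wt-step _ _) , _ , s≤s ()) }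
    reachIn? (suc k) z y | yes pz with z Fin.≟ y
    ... | yes refl = yes (_ , wt-stop , pz ∷ [] , s≤s z≤n)
    ... | no z≢y with Fin.any? (λ u → E? z u ×-dec reachIn? k u y)
    ...   | yes (u , e , _ , w , ps , len) = yes (_ , wt-step e w , pz ∷ ps , s≤s len)
    ...   | no none = no λ { (_ , wt-stop , _) → z≢y refl
                           ; (_ , wt-step e w , _ ∷ ps , s≤s len) → none (_ , e , _ , w , ps , len) }

  reachWithin? : ∀ z y → Dec (ReachWithin G P z y)
  reachWithin? z y with reachIn? n z y
  ... | yes (xs , w , ps , _) = yes (xs , w , ps)
  ... | no none = no λ (_ , w , ps) →
    let ys , w′ , u , ys⊆xs = shortcut Fin._≟_ w in
    none (ys , w′ , All.tabulate (λ u∈ys → All.lookup ps (ys⊆xs u∈ys)) , m≤n⇒m≤1+n (unique⇒length≤n u))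

-- Ranked decompositions and elimination forests

record Ranking (F : RootedForest V) : Set where
  field
    rank           : V → ℕ
    rank-injective : ∀ {x y} → rank x ≡ rank y → x ≡ y
    rank-monotone  : ∀ {x y} → Anc F x y → rank x ≤ rank y

module _ {n} {F : RootedForest (Fin n)} (isF : IsForest F) where

  private
    depth : Fin n → ℕ
    depth x = length (proj₁ (rootPath-exists isF (enumerateFin n) x))

    depth-parent : ∀ {v p} → parent F v ≡ just p → depth v ≡ suc (depth p)
    depth-parent {v} {p} e = cong length (rootPath-deterministic
      (proj₂ (rootPath-exists isF (enumerateFin n) v)) (rp-step e (proj₂ (rootPath-exists isF (enumerateFin n) p))))

    anc⇒≡⊎depth< : ∀ {u v} → Anc F u v → u ≡ v ⊎ depth u < depth v
    anc⇒≡⊎depth< anc-refl = inj₁ refl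
    anc⇒≡⊎depth< (anc-step e u≼p) with anc⇒≡⊎depth< u≼p
    ... | inj₁ refl = inj₂ (≤-reflexive (sym (depth-parent e)))
    ... | inj₂ lt   = inj₂ (≤-trans (m<n⇒m<1+n lt) (≤-reflexive (sym (depth-parent e))))

    -- depth-major, index-minor
    rank : Fin n → ℕ
    rank x = toℕ x + n * depth x

    depth<⇒rank< : ∀ {x y} → depth x < depth y → rank x < rank y
    depth<⇒rank< {x} {y} lt = begin-strict
      toℕ x + n * depth x <⟨ +-monoˡ-< (n * depth x) (Fin.toℕ<n x) ⟩
      n + n * depth x     ≡⟨ *-suc n (depth x) ⟨
      n * suc (depth x)   ≤⟨ *-monoʳ-≤ n lt ⟩
      n * depth y         ≤⟨ m≤n+m (n * depth y) (toℕ y) ⟩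
      rank y              ∎
      where open ≤-Reasoning

  forest-ranking : Ranking F
  forest-ranking = record { rank = rank ; rank-injective = injective ; rank-monotone = monotone }
    where
    injective : ∀ {x y} → rank x ≡ rank y → x ≡ y
    injective {x} {y} eq with <-cmp (depth x) (depth y)
    ... | tri< lt _ _ = ⊥-elim (<⇒≢ (depth<⇒rank< lt) eq)
    ... | tri> _ _ gt = ⊥-elim (<⇒≢ (depth<⇒rank< gt) (sym eq))
    ... | tri≈ _ d≡ _ = Fin.toℕ-injective (+-cancelʳ-≡ (n * depth y) (toℕ x) (toℕ y)
                          (subst (λ d → toℕ x + n * d ≡ rank y) d≡ eq))

    monotone : ∀ {x y} → Anc F x y → rank x ≤ rank y
    monotone x≼y with anc⇒≡⊎depth< x≼y
    ... | inj₁ refl = ≤-refl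
    ... | inj₂ lt   = <⇒≤ (depth<⇒rank< lt)

module RankedDecomposition {G : Graph V} {F : RootedForest V} (comparable : ∀ u v → E G u v → Comparable F u v)
                           (ranking : Ranking F) where
  open Ranking ranking

  -- The rank of y is at most that of every vertex on the walk, so whenever the walk meets
  -- an ancestor of y, the two are equal.
  reachAbove⇒anc : ∀ {u y} → ReachWithin G (λ z → rank y ≤ rank z) u y → Anc F y u
  reachAbove⇒anc (_ , w , ps) = go w ps
    where
    go : ∀ {u y xs} → WalkThrough G u y xs → All (λ z → rank y ≤ rank z) xs → Anc F y u
    go wt-stop _ = anc-refl
    go {u} (wt-step {z = z} u~z w) (y≤u ∷ ps) with go w ps | comparable u z u~z
    ... | y≼z | inj₂ z≼u = anc-trans y≼z z≼u
    ... | y≼z | inj₁ u≼z with ancestors-comparable u≼z y≼z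
    ...   | inj₂ y≼u = y≼u
    ...   | inj₁ u≼y with rank-injective (≤-antisym (rank-monotone u≼y) y≤u)
    ...     | refl = anc-refl

module EliminationForest {n} (G : Graph (Fin n)) (E? : ∀ x y → Dec (E G x y)) (connected : Connected G)
                         (rank : Fin n → ℕ) (rank-injective : ∀ {x y} → rank x ≡ rank y → x ≡ y) where

  Above : Fin n → Fin n → Set
  Above y z = rank y ≤ rank z

  -- c lies in the component of x in the subgraph induced by the vertices of rank ≥ rank x
  InComponent : Fin n → Fin n → Set
  InComponent x c = ReachWithin G (Above x) c x

  inComponent? : ∀ x c → Dec (InComponent x c)
  inComponent? x c = reachWithin? E? (λ z → rank x ≤? rank z) c x

  Candidate : Fin n → Fin n → Set
  Candidate x y = rank y < rank x × ∃ λ c → InComponent x c × E G c y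

  candidate? : ∀ x y → Dec (Candidate x y)
  candidate? x y = rank y <? rank x ×-dec Fin.any? λ c → inComponent? x c ×-dec E? c y

  elimParent : Fin n → Maybe (Fin n)
  elimParent x with filter (candidate? x) (allFin n)
  ... | []     = nothing
  ... | c ∷ cs = just (argmax rank c cs)

  elimForest : RootedForest (Fin n)
  elimForest = record { parent = elimParent }

  private
    F* = elimForest

  parent-candidate : ∀ {x p} → parent F* x ≡ just p → Candidate x p
  parent-candidate {x} e with filter (candidate? x) (allFin n) in eq
  parent-candidate {x} refl | c ∷ cs =
    argmax-all rank (All.head candidates) (All.tail candidates)
    where
    candidates : All (Candidate x) (c ∷ cs)
    candidates = subst (All (Candidate x)) eq (all-filter (candidate? x) (allFin n))

  parent-maximal : ∀ {x p y} → parent F* x ≡ just p → Candidate x y → rank y ≤ rank p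
  parent-maximal {x} {y = y} e cy with filter (candidate? x) (allFin n) in eq
  parent-maximal {x} {y = y} refl cy | c ∷ cs with subst (y ∈_) eq (∈-filter⁺ (candidate? x) (∈-allFin y) cy)
  ... | here refl   = f[⊥]≤f[argmax] {f = rank} c cs
  ... | there y∈cs = All.lookup (f[xs]≤f[argmax] {f = rank} c cs) y∈cs

  candidate⇒parent : ∀ {x y} → Candidate x y → ∃ λ p → parent F* x ≡ just p
  candidate⇒parent {x} {y} cy with filter (candidate? x) (allFin n) in eq
       | ∈-filter⁺ (candidate? x) (∈-allFin y) cy
  ... | c ∷ cs | _ = argmax rank c cs , refl

  parent-rank< : ∀ {x p} → parent F* x ≡ just p → rank p < rank x
  parent-rank< e = proj₁ (parent-candidate e)

  anc-rank≤ : ∀ {y x} → Anc F* y x → rank y ≤ rank x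
  anc-rank≤ anc-refl = ≤-refl
  anc-rank≤ (anc-step e y≼p) = ≤-trans (anc-rank≤ y≼p) (<⇒≤ (parent-rank< e))

  elimForest-isForest : IsForest F*
  elimForest-isForest v (p , e , v≼p) = <⇒≱ (parent-rank< e) (anc-rank≤ v≼p)

  anc⇒reachAbove : ∀ {y x} → Anc F* y x → ReachWithin G (Above y) x y
  anc⇒reachAbove anc-refl = reach-refl ≤-refl
  anc⇒reachAbove {y} (anc-step e y≼p) =
    let p<x , c , c∈Cx , c~p = parent-candidate e
        y≤x = ≤-trans (anc-rank≤ y≼p) (<⇒≤ p<x)
        x⇝c = reach-sym (reach-mono (≤-trans y≤x) c∈Cx)
    in reach-trans x⇝c (reach-step (reach-start (reach-sym x⇝c)) c~p (anc⇒reachAbove y≼p))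

  -- A walk from x down to y leaves the component of x through an edge c q; then q is a
  -- candidate, so x has a parent p of rank at least rank q, and p again reaches y.
  reachAbove⇒anc′ : ∀ {x y} → Acc _<_ (rank x) → rank y ≤ rank x → ReachWithin G (Above y) x y → Anc F* y x
  reachAbove⇒anc′ {x} {y} (acc rs) y≤x x⇝y with x Fin.≟ y
  ... | yes refl = anc-refl
  ... | no x≢y with reach-exit (inComponent? x) (reach-refl ≤-refl) (λ y∈Cx → <⇒≱ y<x (reach-start y∈Cx)) x⇝y
    where y<x = ≤∧≢⇒< y≤x λ eq → x≢y (sym (rank-injective eq))
  ...   | c , q , c∈Cx , c~q , q∉Cx , q⇝y =
    let q<x = ≰⇒> λ x≤q → q∉Cx (reach-step x≤q (E-sym G c~q) c∈Cx)
        p , e = candidate⇒parent (q<x , c , c∈Cx , c~q)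
        p<x , c′ , c′∈Cx , c′~p = parent-candidate e
        y≤p = ≤-trans (reach-start q⇝y) (parent-maximal e (q<x , c , c∈Cx , c~q))
    in anc-step e (reachAbove⇒anc′ (rs p<x) y≤p
         (reach-step y≤p (E-sym G c′~p) (reach-trans (reach-mono (≤-trans y≤x) c′∈Cx) x⇝y)))

  reachAbove⇒anc : ∀ {x y} → rank y ≤ rank x → ReachWithin G (Above y) x y → Anc F* y x
  reachAbove⇒anc = reachAbove⇒anc′ (<-wellFounded _)

  inComponent⇒anc : ∀ {x c} → InComponent x c → Anc F* x c
  inComponent⇒anc c∈Cx = reachAbove⇒anc (reach-start c∈Cx) c∈Cx

  elimForest-comparable : ∀ u v → E G u v → Comparable F* u v
  elimForest-comparable u v u~v with <-cmp (rank u) (rank v)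
  ... | tri< u<v _ _ = inj₁ (reachAbove⇒anc (<⇒≤ u<v) (reach-step (<⇒≤ u<v) (E-sym G u~v) (reach-refl ≤-refl)))
  ... | tri≈ _ u≡v _ = ⊥-elim (irrefl G (subst (E G u) (sym (rank-injective u≡v)) u~v))
  ... | tri> _ _ u>v = inj₂ (reachAbove⇒anc (<⇒≤ u>v) (reach-step (<⇒≤ u>v) u~v (reach-refl ≤-refl)))

  root : Fin n
  root = argmin rank (proj₁ connected) (allFin n)

  root-minimal : ∀ y → rank root ≤ rank y
  root-minimal y = All.lookup (f[argmin]≤f[xs] {f = rank} (proj₁ connected) (allFin n)) (∈-allFin y)

  root-isRoot : IsRoot F* root
  root-isRoot with parent F* root in e
  ... | nothing = refl
  ... | just p  = ⊥-elim (<⇒≱ (parent-rank< e) (root-minimal p))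

  root-unique : ∀ r → IsRoot F* r → r ≡ root
  root-unique r r-isRoot with r Fin.≟ root
  ... | yes r≡root = r≡root
  ... | no r≢root with walk⇒walkThrough (proj₂ connected r root)
  ...   | xs , w with anc-≢⇒sanc (reachAbove⇒anc (root-minimal r) (xs , w , All.tabulate λ {z} _ → root-minimal z))
                                   (λ root≡r → r≢root (sym root≡r))
  ...     | _ , e , _ = case trans (sym e) r-isRoot of λ ()

  record Connector (x : Fin n) : Set where
    field
      start  : Fin n
      onward : List (Fin n)
      walk   : WalkThrough G start x (start ∷ onward)
      unique : Unique (start ∷ onward)
      below  : ∀ {z} → z ∈ start ∷ onward → Anc F* x z
      link   : ∀ {p} → parent F* x ≡ just p → E G start p

  opaque
    connector : ∀ x → Connector x
    connector x with parent F* x in e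
    ... | nothing = record
      { start = x ; onward = [] ; walk = wt-stop ; unique = [] ∷ []
      ; below = λ { (here refl) → anc-refl } ; link = λ e′ → case trans (sym e) e′ of λ () }
    ... | just p with parent-candidate e
    ...   | _ , c , (xs , w , above) , c~p with shortcut Fin._≟_ w
    ...     | ys , w′ , u , ys⊆xs with walkThrough-start w′
    ...       | _ , refl = record
      { start = c ; onward = _ ; walk = w′ ; unique = u
      ; below = λ z∈ys → inComponent⇒anc (reach-from w above (ys⊆xs z∈ys))
      ; link = λ e′ → subst (E G c) (just-injective (trans (sym e) e′)) c~p }

-- Expanding and restricting forests

module ListPositions {A : Set} (_≟_ : DecidableEquality A) where

  position : A → List A → ℕ
  position v [] = 0
  position v (a ∷ L) with v ≟ a
  ... | yes _ = 0
  ... | no _  = suc (position v L)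

  predecessorAfter : A → A → List A → Maybe A
  predecessorAfter a v [] = nothing
  predecessorAfter a v (b ∷ L) with v ≟ b
  ... | yes _ = just a
  ... | no _  = predecessorAfter b v L

  predecessor : A → List A → Maybe A
  predecessor v [] = nothing
  predecessor v (a ∷ L) = predecessorAfter a v L

  lastOf : A → List A → A
  lastOf a []      = a
  lastOf _ (b ∷ L) = lastOf b L

  position-head : ∀ {a : A} {L} → position a (a ∷ L) ≡ 0
  position-head {a} with a ≟ a
  ... | yes _ = refl
  ... | no a≢a = ⊥-elim (a≢a refl)

  position-tail : ∀ {v a : A} {L} → v ≢ a → position v (a ∷ L) ≡ suc (position v L)
  position-tail {v} {a} v≢a with v ≟ a
  ... | yes v≡a = ⊥-elim (v≢a v≡a)
  ... | no _ = refl

  private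
    ∉-head : ∀ {a v : A} {L} → Unique (a ∷ L) → v ∈ L → v ≢ a
    ∉-head (a∉L ∷ _) v∈L v≡a = All.lookup a∉L v∈L (sym v≡a)

    ∈-tail : ∀ {a v : A} {L} → v ∈ a ∷ L → v ≢ a → v ∈ L
    ∈-tail (here v≡a) v≢a = ⊥-elim (v≢a v≡a)
    ∈-tail (there v∈L) _ = v∈L

  position-injective : ∀ {L : List A} {u v : A} → u ∈ L → v ∈ L → position u L ≡ position v L → u ≡ v
  position-injective {a ∷ L} {u} {v} u∈ v∈ eq with u ≟ a | v ≟ a
  ... | yes u≡a | yes v≡a = trans u≡a (sym v≡a)
  ... | yes _   | no _    = case eq of λ ()
  ... | no _    | yes _   = case eq of λ ()
  ... | no u≢a  | no v≢a  = position-injective (∈-tail u∈ u≢a) (∈-tail v∈ v≢a) (suc-injective eq)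

  predecessor-position : ∀ {L : List A} {u v : A} → Unique L → predecessor v L ≡ just u →
                         u ∈ L × v ∈ L × suc (position u L) ≡ position v L
  predecessor-position {a ∷ b ∷ L} {u} {v} uniq@(_ ∷ uniq′) e with v ≟ b
  ... | yes refl with e
  ...   | refl = here refl , there (here refl) ,
                 trans (cong suc position-head)
                   (sym (trans (position-tail (∉-head uniq (here refl))) (cong suc position-head)))
  predecessor-position {a ∷ b ∷ L} uniq@(_ ∷ uniq′) e | no _ with predecessor-position {b ∷ L} uniq′ e
  ... | u∈ , v∈ , eq = there u∈ , there v∈ ,
        trans (cong suc (position-tail (∉-head uniq u∈))) (trans (cong suc eq) (sym (position-tail (∉-head uniq v∈))))

  ∈-tail⇒predecessor : ∀ {a v : A} {L} → v ∈ L → ∃ λ u → predecessor v (a ∷ L) ≡ just u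
  ∈-tail⇒predecessor {a} {v} {b ∷ L} v∈ with v ≟ b
  ... | yes _   = a , refl
  ... | no v≢b = ∈-tail⇒predecessor (∈-tail v∈ v≢b)

  predecessor-adjacent : ∀ {G : Graph A} {L : List A} {u v : A} → IsPath G L → predecessor v L ≡ just u → E G u v
  predecessor-adjacent {L = a ∷ b ∷ L} {v = v} (p-cons a~b path) e with v ≟ b
  ... | yes refl with e
  ...   | refl = a~b
  predecessor-adjacent {L = a ∷ b ∷ L} (p-cons _ path) e | no _ = predecessor-adjacent {L = b ∷ L} path e

  lastOf-last : ∀ (a : A) L → Last (a ∷ L) (lastOf a L)
  lastOf-last a [] = last-one
  lastOf-last a (b ∷ L) = last-cons (lastOf-last b L)

  position≤last : ∀ {L : List A} {u v} → Unique L → Last L v → u ∈ L → position u L ≤ position v L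
  position≤last _ last-one (here refl) = ≤-refl
  position≤last {a ∷ L} {u} uniq@(_ ∷ uniq′) (last-cons l) u∈ with u ≟ a
  ... | yes _ = z≤n
  ... | no u≢a = subst (suc (position u L) ≤_) (sym (position-tail (∉-head uniq (last-∈ l))))
                   (s≤s (position≤last uniq′ l (∈-tail u∈ u≢a)))

module ChainExpansion {F : RootedForest X} (isF : IsForest F) (_≟_ : DecidableEquality V)
                      (owner : V → X) (first : X → V) (rest : X → List V)
                      (block-unique : ∀ x → Unique (first x ∷ rest x))
                      (∈-block : ∀ v → v ∈ first (owner v) ∷ rest (owner v))
                      (owner-block : ∀ {x v} → v ∈ first x ∷ rest x → owner v ≡ x) where

  open ListPositions _≟_

  block : X → List V
  block x = first x ∷ rest x

  last : X → V
  last x = lastOf (first x) (rest x)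

  expandedForest : RootedForest V
  expandedForest = record { parent = λ v → predecessor v (block (owner v)) <∣> Maybe.map last (parent F (owner v)) }

  private
    Fₑ = expandedForest

    pos : V → ℕ
    pos v = position v (block (owner v))

  first-noPredecessor : ∀ {x u} → predecessor (first x) (block x) ≢ just u
  first-noPredecessor {x} e with predecessor-position (block-unique x) e
  ... | _ , _ , eq = case trans eq position-head of λ ()

  noPredecessor⇒first : ∀ {v} → predecessor v (block (owner v)) ≡ nothing → v ≡ first (owner v)
  noPredecessor⇒first {v} e with ∈-block v
  ... | here v≡first = v≡first
  ... | there v∈rest = case trans (sym e) (proj₂ (∈-tail⇒predecessor v∈rest)) of λ ()

  parent-predecessor : ∀ {x u v} → owner v ≡ x → predecessor v (block x) ≡ just u → parent Fₑ v ≡ just u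
  parent-predecessor refl e rewrite e = refl

  parent-first : ∀ x → parent Fₑ (first x) ≡ Maybe.map last (parent F x)
  parent-first x rewrite owner-block {x} (here refl) with predecessor (first x) (block x) in e
  ... | nothing = refl
  ... | just _ = ⊥-elim (first-noPredecessor e)

  parent-cases : ∀ {u v} → parent Fₑ v ≡ just u →
                 predecessor v (block (owner v)) ≡ just u
                 ⊎ (v ≡ first (owner v) × ∃ λ p → parent F (owner v) ≡ just p × u ≡ last p)
  parent-cases {u} {v} e with predecessor v (block (owner v)) in e′ | parent F (owner v)
  ... | just _  | _       = inj₁ e
  ... | nothing | just p  = inj₂ (noPredecessor⇒first e′ , p , refl , sym (just-injective e))

  owner-last : ∀ x → owner (last x) ≡ x
  owner-last x = owner-block (last-∈ (lastOf-last (first x) (rest x)))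

  -- Ancestry in the expansion is ordered lexicographically by (owner in F, position in the block).
  _≺_ : V → V → Set
  u ≺ v = SAnc F (owner u) (owner v) ⊎ (owner u ≡ owner v × pos u < pos v)

  ≺-trans : ∀ {u v w} → u ≺ v → v ≺ w → u ≺ w
  ≺-trans (inj₁ u<v) (inj₁ v<w) = inj₁ (sanc-anc-trans u<v (sanc⇒anc v<w))
  ≺-trans {u} (inj₁ u<v) (inj₂ (ov≡ow , _)) = inj₁ (subst (SAnc F (owner u)) ov≡ow u<v)
  ≺-trans {w = w} (inj₂ (ou≡ov , _)) (inj₁ v<w) = inj₁ (subst (λ x → SAnc F x (owner w)) (sym ou≡ov) v<w)
  ≺-trans (inj₂ (ou≡ov , u<v)) (inj₂ (ov≡ow , v<w)) = inj₂ (trans ou≡ov ov≡ow , <-trans u<v v<w)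

  parent-≺ : ∀ {u v} → parent Fₑ v ≡ just u → u ≺ v
  parent-≺ {u} {v} e with parent-cases e
  ... | inj₁ e′ =
    let u∈ , _ , eq = predecessor-position (block-unique (owner v)) e′
        same = owner-block u∈
    in inj₂ (same , subst (λ x → suc (position u (block x)) ≤ pos v) (sym same) (≤-reflexive eq))
  ... | inj₂ (_ , p , e′ , refl) = inj₁ (_ , e′ , subst (λ x → Anc F x p) (sym (owner-last p)) anc-refl)

  sanc⇒≺ : ∀ {u v} → SAnc Fₑ u v → u ≺ v
  sanc⇒≺ (_ , e , u≼p) = go u≼p e
    where
    go : ∀ {u p v} → Anc Fₑ u p → parent Fₑ v ≡ just p → u ≺ v
    go anc-refl e = parent-≺ e
    go (anc-step e′ u≼q) e = ≺-trans (go u≼q e′) (parent-≺ e)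

  expandedForest-isForest : IsForest Fₑ
  expandedForest-isForest v v<v with sanc⇒≺ v<v
  ... | inj₁ ov<ov = isF (owner v) ov<ov
  ... | inj₂ (_ , pv<pv) = <-irrefl refl pv<pv

  anc-owner : ∀ {u v} → Anc Fₑ u v → Anc F (owner u) (owner v)
  anc-owner anc-refl = anc-refl
  anc-owner (anc-step e u≼p) with sanc⇒≺ (_ , e , u≼p)
  ... | inj₁ ou<ov = sanc⇒anc ou<ov
  ... | inj₂ (ou≡ov , _) = subst (Anc F _) ou≡ov anc-refl

  block-anc : ∀ {x u v} → u ∈ block x → v ∈ block x → position u (block x) ≤ position v (block x) → Anc Fₑ u v
  block-anc {x} {u} u∈ v∈ u≤v = go _ v∈ refl u≤v
    where
    go : ∀ k {v} → v ∈ block x → position v (block x) ≡ k → position u (block x) ≤ k → Anc Fₑ u v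
    go zero v∈ v≡0 u≤0 =
      subst (λ z → Anc Fₑ z _) (sym (position-injective u∈ v∈ (trans (n≤0⇒n≡0 u≤0) (sym v≡0)))) anc-refl
    go (suc k) v∈ v≡k+1 u≤k+1 with position u (block x) ≟ℕ suc k
    ... | yes u≡k+1 = subst (λ z → Anc Fₑ z _) (sym (position-injective u∈ v∈ (trans u≡k+1 (sym v≡k+1)))) anc-refl
    ... | no u≢k+1 with v∈
    ...   | here refl = case trans (sym v≡k+1) position-head of λ ()
    ...   | there v∈rest =
      let p , e = ∈-tail⇒predecessor v∈rest
          p∈ , _ , p+1≡v = predecessor-position (block-unique x) e
      in anc-step (parent-predecessor (owner-block v∈) e)
                  (go k p∈ (suc-injective (trans p+1≡v v≡k+1)) (≤-pred (≤∧≢⇒< u≤k+1 u≢k+1)))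

  first-anc : ∀ {x v} → v ∈ block x → Anc Fₑ (first x) v
  first-anc {x} {v} v∈ = block-anc (here refl) v∈ (subst (_≤ position v (block x)) (sym position-head) z≤n)

  anc-last : ∀ {x u} → u ∈ block x → Anc Fₑ u (last x)
  anc-last {x} u∈ = block-anc u∈ (last-∈ last-x) (position≤last (block-unique x) last-x u∈)
    where last-x = lastOf-last (first x) (rest x)

  last-anc-first : ∀ {x p} → parent F x ≡ just p → Anc Fₑ (last p) (first x)
  last-anc-first {x} e = anc-step (trans (parent-first x) (cong (Maybe.map last) e)) anc-refl

  sanc-blocks : ∀ {x y u v} → SAnc F x y → u ∈ block x → v ∈ block y → Anc Fₑ u v
  sanc-blocks (p , e , x≼p) u∈ v∈ = anc-trans (anc-trans (go x≼p) (last-anc-first e)) (first-anc v∈)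
    where
    go : ∀ {y} → Anc F _ y → Anc Fₑ _ (last y)
    go anc-refl = anc-last u∈
    go (anc-step e x≼p) = anc-trans (go x≼p) (anc-trans (last-anc-first e) (anc-last (here refl)))

  comparable-owners : ∀ {u v} → Comparable F (owner u) (owner v) → Comparable Fₑ u v
  comparable-owners {u} {v} (inj₁ ou≼ov) = anc-blocks ou≼ov (∈-block u) (∈-block v)
    where
    anc-blocks : ∀ {x y u v} → Anc F x y → u ∈ block x → v ∈ block y → Comparable Fₑ u v
    anc-blocks {x} {u = u} {v} anc-refl u∈ v∈ with ≤-total (position u (block x)) (position v (block x))
    ... | inj₁ u≤v = inj₁ (block-anc u∈ v∈ u≤v)
    ... | inj₂ v≤u = inj₂ (block-anc v∈ u∈ v≤u)
    anc-blocks (anc-step e x≼p) u∈ v∈ = inj₁ (sanc-blocks (_ , e , x≼p) u∈ v∈)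
  comparable-owners (inj₂ ov≼ou) = Data.Sum.swap (comparable-owners (inj₁ ov≼ou))

  first-isRoot : ∀ {x} → IsRoot F x → IsRoot Fₑ (first x)
  first-isRoot {x} x-root = trans (parent-first x) (cong (Maybe.map last) x-root)

  isRoot-first : ∀ {r} → IsRoot Fₑ r → IsRoot F (owner r) × r ≡ first (owner r)
  isRoot-first {r} r-root with predecessor r (block (owner r)) in e | parent F (owner r)
  ... | nothing | nothing = refl , noPredecessor⇒first e

  parent-adjacent : {G : Graph V} → (∀ x → IsPath G (block x)) →
                    (∀ {x p} → parent F x ≡ just p → E G (first x) (last p)) →
                    ∀ {u v} → parent Fₑ v ≡ just u → E G v u
  parent-adjacent {G} paths links e with parent-cases e
  ... | inj₁ e′ = E-sym G (predecessor-adjacent (paths _) e′)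
  ... | inj₂ (v≡first , p , e′ , refl) = subst (λ z → E G z (last p)) (sym v≡first) (links e′)

  expandedForest-height≤ : ∀ {v xs ys} → RootPath Fₑ v xs → RootPath F (owner v) ys →
                           length xs ≤ sum (map (length ∘ block) ys)
  expandedForest-height≤ {v} {xs} {ys} r r′ = begin
    length xs                    ≤⟨ unique-⊆⇒length≤ (rootPath-unique expandedForest-isForest r) xs⊆ ⟩
    length (concatMap block ys)  ≡⟨ length-concatMap block ys ⟩
    sum (map (length ∘ block) ys) ∎
    where
    open ≤-Reasoning
    xs⊆ : xs ⊆ concatMap block ys
    xs⊆ {u} u∈xs = ∈-concatMap⁺ block (lose (anc⇒∈rootPath r′ (anc-owner (rootPath-anc r u∈xs))) (∈-block u))

module RestrictedForest {F : RootedForest V} (isF : IsForest F) (enum : Enumeration V)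
                        (embed : X → V) (preimage : V → Maybe X)
                        (preimage-embed : ∀ x → preimage (embed x) ≡ just x)
                        (embed-preimage : ∀ {u x} → preimage u ≡ just x → embed x ≡ u) where

  firstImage : List V → Maybe X
  firstImage [] = nothing
  firstImage (u ∷ us) = preimage u <∣> firstImage us

  firstImage-∈ : ∀ {us x} → firstImage us ≡ just x → embed x ∈ us
  firstImage-∈ {u ∷ us} e with preimage u in e′
  ... | just _ = here (embed-preimage (trans e′ e))
  ... | nothing = there (firstImage-∈ e)

  ∈⇒firstImage : ∀ {us y} → embed y ∈ us → ∃ λ x → firstImage us ≡ just x
  ∈⇒firstImage {u ∷ us} y∈ with preimage u in e | y∈
  ... | just x  | _ = x , refl
  ... | nothing | here refl = case trans (sym (preimage-embed _)) e of λ ()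
  ... | nothing | there y∈us = ∈⇒firstImage y∈us

  firstImage-embed : ∀ {y us x} → firstImage (embed y ∷ us) ≡ just x → y ≡ x
  firstImage-embed {y} {us} e = just-injective (trans (sym (cong (_<∣> firstImage us) (preimage-embed y))) e)

  rootPathOf : V → List V
  rootPathOf u = proj₁ (rootPath-exists isF enum u)

  restrictedForest : RootedForest X
  restrictedForest = record { parent = λ x → parent F (embed x) Maybe.>>= λ p → firstImage (rootPathOf p) }

  private
    Fᵣ = restrictedForest

  parent-sanc : ∀ {x y} → parent Fᵣ x ≡ just y → SAnc F (embed y) (embed x)
  parent-sanc {x} e with parent F (embed x)
  ... | just p = p , refl , rootPath-anc (proj₂ (rootPath-exists isF enum p)) (firstImage-∈ e)

  anc-embed : ∀ {x y} → Anc Fᵣ y x → Anc F (embed y) (embed x)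
  anc-embed anc-refl = anc-refl
  anc-embed (anc-step e y≼p) = anc-trans (anc-embed y≼p) (sanc⇒anc (parent-sanc e))

  restrictedForest-isForest : IsForest Fᵣ
  restrictedForest-isForest x (p , e , x≼p) with parent-sanc e
  ... | q , e′ , p≼q = isF (embed x) (q , e′ , anc-trans (anc-embed x≼p) p≼q)

  private
    parent-firstImage : ∀ {x p ys z} → parent F (embed x) ≡ just p → RootPath F p ys → firstImage ys ≡ just z →
                        parent Fᵣ x ≡ just z
    parent-firstImage {x} {p} e r e′ rewrite e =
      trans (cong firstImage (rootPath-deterministic (proj₂ (rootPath-exists isF enum p)) r)) e′

    embed-anc : ∀ {v ys x y} → RootPath F v ys → firstImage ys ≡ just x → Anc F (embed y) v → Anc Fᵣ y x
    embed-anc (rp-root _) e anc-refl = subst (Anc Fᵣ _) (firstImage-embed {us = []} e) anc-refl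
    embed-anc (rp-step {xs = ys} _ _) e anc-refl = subst (Anc Fᵣ _) (firstImage-embed {us = ys} e) anc-refl
    embed-anc (rp-root e) _ (anc-step e′ _) = case trans (sym e) e′ of λ ()
    embed-anc {v} (rp-step e r) e″ (anc-step e′ y≼p) with trans (sym e) e′
    ... | refl with preimage v in pre-v
    ...   | nothing = embed-anc r e″ y≼p
    ...   | just x′ with e″
    ...     | refl with ∈⇒firstImage (anc⇒∈rootPath r y≼p)
    ...       | z , e‴ = anc-step (parent-firstImage (subst (λ u → parent F u ≡ _) (sym (embed-preimage pre-v)) e) r e‴)
                                  (embed-anc r e‴ y≼p)

  embed-anc⇒anc : ∀ {x y} → Anc F (embed y) (embed x) → Anc Fᵣ y x
  embed-anc⇒anc {x} y≼x with rootPath-exists isF enum (embed x)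
  ... | _ , r@(rp-root _)   = embed-anc r (cong (_<∣> nothing) (preimage-embed x)) y≼x
  ... | _ , r@(rp-step {xs = ys} _ _) = embed-anc r (cong (_<∣> firstImage ys) (preimage-embed x)) y≼x

-- The blow-up graph

module BlowUp {n} (T : Graph (Fin n)) (w : Fin n → ℕ) (M : ℕ) where

  GV : Set
  GV = GMV w M

  G : Graph GV
  G = GM T w M

  _≟_ : DecidableEquality GV
  _≟_ = ≡-dec Fin._≟_ Fin._≟_

  vertex : (x : Fin n) → Fin (w x * M) → GV
  vertex x i = x , i

  class : Fin n → List GV
  class x = tabulate (vertex x)

  vertex-injective : ∀ {x} {i j : Fin (w x * M)} → vertex x i ≡ vertex x j → i ≡ j
  vertex-injective eq = Fin.toℕ-injective (cong (toℕ ∘ proj₂) eq)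

  sameClass-adjacent : ∀ {u v : GV} → proj₁ u ≡ proj₁ v → u ≢ v → E G u v
  sameClass-adjacent {_ , _} {_ , _} refl u≢v = inj₁ (refl , u≢v)

  clique-isPath : ∀ {x} v vs → Unique (v ∷ vs) → All (λ u → proj₁ u ≡ x) (v ∷ vs) → IsPath G (v ∷ vs)
  clique-isPath v [] _ _ = p-one
  clique-isPath v (u ∷ vs) ((v≢u ∷ _) ∷ uniq) (v≡x ∷ u≡x ∷ same) =
    p-cons (sameClass-adjacent (trans v≡x (sym u≡x)) v≢u) (clique-isPath u vs uniq (u≡x ∷ same))

module DFSTreeFromDecomposition {n} (T : Graph (Fin n)) (tree : IsTree T)
                                {F : RootedForest (Fin n)} (td : IsTDDecomp T F)
                                (w : Fin n → ℕ) (w-pos : ∀ x → 1 ≤ w x) (M : ℕ) (n≤M : n ≤ M) where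

  ranking : Ranking F
  ranking = forest-ranking (proj₁ td)

  open Ranking ranking
  open EliminationForest T (tree-adjacent? Fin._≟_ tree) (proj₁ tree) rank rank-injective

  elim⇒anc : ∀ {y x} → Anc elimForest y x → Anc F y x
  elim⇒anc y≼x = RankedDecomposition.reachAbove⇒anc (proj₂ td) ranking (anc⇒reachAbove y≼x)

  start : Fin n → Fin n
  start x = Connector.start (connector x)

  path : Fin n → List (Fin n)
  path x = start x ∷ Connector.onward (connector x)

  open BlowUp T w M

  -- copy x z is the vertex of V_z set aside for the connector of x; it exists because
  -- there are at least M ≥ n vertices in V_z.
  opaque
    copyIndex : Fin n → (z : Fin n) → Fin (w z * M)
    copyIndex x z = fromℕ< (<-≤-trans (Fin.toℕ<n x) (≤-trans n≤M M≤|Vz|))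
      where
      M≤|Vz| : M ≤ w z * M
      M≤|Vz| = subst (_≤ w z * M) (*-identityˡ M) (*-monoˡ-≤ M (w-pos z))

    toℕ-copyIndex : ∀ x z → toℕ (copyIndex x z) ≡ toℕ x
    toℕ-copyIndex x z = Fin.toℕ-fromℕ< _

  copy : Fin n → Fin n → GV
  copy x z = z , copyIndex x z

  copy-injective : ∀ x {z z′} → copy x z ≡ copy x z′ → z ≡ z′
  copy-injective x = ,-injectiveˡ

  IsCopy : GV → Set
  IsCopy (z , i) = ∃ λ x → toℕ x ≡ toℕ i × z ∈ path x

  isCopy? : ∀ v → Dec (IsCopy v)
  isCopy? (z , i) = Fin.any? λ x → (toℕ x ≟ℕ toℕ i) ×-dec DecMembership._∈?_ Fin._≟_ z (path x)

  copy-isCopy : ∀ {x z} → z ∈ path x → IsCopy (copy x z)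
  copy-isCopy {x} {z} z∈ = x , sym (toℕ-copyIndex x z) , z∈

  isCopy⇒≡copy : ∀ {z i} ((x , _) : IsCopy (z , i)) → (z , i) ≡ copy x z
  isCopy⇒≡copy {z} (x , x≡i , _) = cong (z ,_) (Fin.toℕ-injective (trans (sym x≡i) (sym (toℕ-copyIndex x z))))

  opaque
    owner : GV → Fin n
    owner v with isCopy? v
    ... | yes (x , _) = x
    ... | no _ = proj₁ v

    owner-copy : ∀ {x z} → z ∈ path x → owner (copy x z) ≡ x
    owner-copy {x} {z} z∈ with isCopy? (copy x z)
    ... | yes (x′ , x′≡x , _) = Fin.toℕ-injective (trans x′≡x (toℕ-copyIndex x z))
    ... | no ¬copy = ⊥-elim (¬copy (copy-isCopy z∈))

    owner-nonCopy : ∀ {v} → ¬ IsCopy v → owner v ≡ proj₁ v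
    owner-nonCopy {v} ¬copy with isCopy? v
    ... | yes copy = ⊥-elim (¬copy copy)
    ... | no _ = refl

  opaque
    spareIndices : ∀ x → List (Fin (w x * M))
    spareIndices x = filter (λ i → ¬? (isCopy? (x , i))) (allFin (w x * M))

    spare : Fin n → List GV
    spare x = map (vertex x) (spareIndices x)

    ∈-spare⁻ : ∀ {x v} → v ∈ spare x → proj₁ v ≡ x × ¬ IsCopy v
    ∈-spare⁻ {x} v∈ =
      let i , i∈ , v≡xi = ∈-map⁻ (vertex x) v∈
          i-spare = proj₂ (∈-filter⁻ (λ i → ¬? (isCopy? (x , i))) {xs = allFin _} i∈)
      in cong proj₁ v≡xi , λ c → i-spare (subst IsCopy v≡xi c)

    ∈-spare⁺ : ∀ {x i} → ¬ IsCopy (x , i) → (x , i) ∈ spare x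
    ∈-spare⁺ {x} ¬copy = ∈-map⁺ (vertex x) (∈-filter⁺ (λ i → ¬? (isCopy? (x , i))) (∈-allFin _) ¬copy)

    spare-unique : ∀ x → Unique (spare x)
    spare-unique x = Unique.map⁺ vertex-injective
                       (Unique.filter⁺ (λ i → ¬? (isCopy? (x , i))) (Unique.allFin⁺ (w x * M)))

    length-spare : ∀ x → length (spare x) ≤ w x * M
    length-spare x = begin
      length (spare x)          ≡⟨ length-map (vertex x) (spareIndices x) ⟩
      length (spareIndices x)   ≤⟨ length-filter (λ i → ¬? (isCopy? (x , i))) (allFin (w x * M)) ⟩
      length (allFin (w x * M)) ≡⟨ length-tabulate {n = w x * M} (λ i → i) ⟩
      w x * M                   ∎
      where open ≤-Reasoning

  first : Fin n → GV
  first x = copy x (start x)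

  rest : Fin n → List GV
  rest x = map (copy x) (Connector.onward (connector x)) ++ spare x

  block : Fin n → List GV
  block x = first x ∷ rest x

  copies-∉-spare : ∀ {x v} → v ∈ map (copy x) (path x) → v ∉ spare x
  copies-∉-spare {x} v∈copies v∈spare with ∈-map⁻ (copy x) v∈copies
  ... | z , z∈ , refl = proj₂ (∈-spare⁻ v∈spare) (copy-isCopy z∈)

  block-unique : ∀ x → Unique (block x)
  block-unique x = Unique.++⁺ (Unique.map⁺ (copy-injective x) (Connector.unique (connector x))) (spare-unique x)
                     λ (v∈copies , v∈spare) → copies-∉-spare v∈copies v∈spare

  owner-block : ∀ {x v} → v ∈ block x → owner v ≡ x
  owner-block {x} v∈ with ∈-++⁻ (map (copy x) (path x)) v∈
  ... | inj₁ v∈copies with ∈-map⁻ (copy x) v∈copies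
  ...   | z , z∈ , refl = owner-copy z∈
  owner-block v∈ | inj₂ v∈spare = let v≡x , ¬copy = ∈-spare⁻ v∈spare in trans (owner-nonCopy ¬copy) v≡x

  ∈-block : ∀ v → v ∈ block (owner v)
  ∈-block (z , i) with isCopy? (z , i)
  ... | yes c@(x , _ , z∈) rewrite isCopy⇒≡copy c = subst (λ y → copy x z ∈ block y) (sym (owner-copy z∈))
                                                             (∈-++⁺ˡ (∈-map⁺ (copy x) z∈))
  ... | no ¬copy = subst (λ y → (z , i) ∈ block y) (sym (owner-nonCopy ¬copy))
                          (∈-++⁺ʳ (map (copy z) (path z)) (∈-spare⁺ ¬copy))

  open ChainExpansion elimForest-isForest _≟_ owner first rest block-unique ∈-block owner-block
    hiding (block) public

  block-isPath : ∀ x → IsPath G (block x)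
  block-isPath x = lift (Connector.walk (connector x))
    where
    x∈path = walkThrough-end (Connector.walk (connector x))
    tail-isPath : IsPath G (copy x x ∷ spare x)
    tail-isPath = clique-isPath (copy x x) (spare x)
      (All.tabulate (λ v∈spare copy≡v → proj₂ (∈-spare⁻ v∈spare) (subst IsCopy copy≡v (copy-isCopy x∈path)))
        ∷ spare-unique x)
      (refl ∷ All.tabulate (λ v∈spare → proj₁ (∈-spare⁻ v∈spare)))
    lift : ∀ {z zs} → WalkThrough T z x zs → IsPath G (map (copy x) zs ++ spare x)
    lift wt-stop = tail-isPath
    lift (wt-step e wt-stop) = p-cons (inj₂ e) tail-isPath
    lift (wt-step e w@(wt-step _ _)) = p-cons (inj₂ e) (lift w)

  last-class : ∀ x → proj₁ (last x) ≡ x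
  last-class x with last-++⁻ (first x) (map (copy x) (Connector.onward (connector x)))
                      (ListPositions.lastOf-last _≟_ (first x) (rest x))
  ... | inj₁ l = cong proj₁ (last-unique l (last-map (copy x) (walkThrough-last (Connector.walk (connector x)))))
  ... | inj₂ v∈spare = proj₁ (∈-spare⁻ v∈spare)

  first-adjacent-last : ∀ {x p} → parent elimForest x ≡ just p → E G (first x) (last p)
  first-adjacent-last {x} {p} e = inj₂ (subst (E T (start x)) (sym (last-class p)) (Connector.link (connector x) e))

  below-owner : ∀ v → Anc elimForest (owner v) (proj₁ v)
  below-owner (z , i) with isCopy? (z , i)
  ... | yes c@(x , _ , z∈) = subst (λ y → Anc elimForest y z)
                               (sym (trans (cong owner (isCopy⇒≡copy c)) (owner-copy z∈))) (Connector.below (connector x) z∈)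
  ... | no ¬copy = subst (λ y → Anc elimForest y z) (sym (owner-nonCopy ¬copy)) anc-refl

  edge-comparable : ∀ u v → E G u v → Comparable expandedForest u v
  edge-comparable u v u~v = comparable-owners (owners-comparable (classes-comparable u v u~v))
    where
    classes-comparable : ∀ u v → E G u v → Comparable elimForest (proj₁ u) (proj₁ v)
    classes-comparable (_ , _) (_ , _) (inj₁ (refl , _)) = inj₁ anc-refl
    classes-comparable (_ , _) (_ , _) (inj₂ e) = elimForest-comparable _ _ e
    owners-comparable : Comparable elimForest (proj₁ u) (proj₁ v) → Comparable elimForest (owner u) (owner v)
    owners-comparable (inj₁ zu≼zv) = ancestors-comparable (anc-trans (below-owner u) zu≼zv) (below-owner v)
    owners-comparable (inj₂ zv≼zu) = ancestors-comparable (below-owner u) (anc-trans (below-owner v) zv≼zu)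

  isDFSTree : IsDFSTree G expandedForest
  isDFSTree = expandedForest-isForest
            , (first root , first-isRoot root-isRoot , λ r r-root →
                 let owner-root , r≡first = isRoot-first r-root in trans r≡first (cong first (root-unique _ owner-root)))
            , (λ v p e → parent-adjacent block-isPath first-adjacent-last e)
            , edge-comparable

  block-length : ∀ x → length (block x) ≤ n + w x * M
  block-length x = begin
    length (map (copy x) (path x) ++ spare x)         ≡⟨ length-++ (map (copy x) (path x)) ⟩
    length (map (copy x) (path x)) + length (spare x) ≡⟨ cong (_+ length (spare x)) (length-map (copy x) (path x)) ⟩
    length (path x) + length (spare x)                ≤⟨ +-mono-≤ (unique⇒length≤n (Connector.unique (connector x)))
                                                                   (length-spare x) ⟩
    n + w x * M                                       ∎
    where open ≤-Reasoning

  blocks-length : ∀ xs → sum (map (length ∘ block) xs) ≤ n * length xs + sum (map w xs) * M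
  blocks-length [] = z≤n
  blocks-length (x ∷ xs) = begin
    length (block x) + sum (map (length ∘ block) xs)      ≤⟨ +-mono-≤ (block-length x) (blocks-length xs) ⟩
    n + w x * M + (n * length xs + sum (map w xs) * M)    ≡⟨ regroup n (w x) M (length xs) (sum (map w xs)) ⟩
    n * suc (length xs) + (w x + sum (map w xs)) * M      ∎
    where
    open ≤-Reasoning
    regroup : ∀ a b c d e → a + b * c + (a * d + e * c) ≡ a * suc d + (b + e) * c
    regroup = solve-∀

  dfsTree-height≤ : ∀ t → WeightBound F w t → HeightAtMost expandedForest (M * t + n * n)
  dfsTree-height≤ t weight≤t v xs r = begin
    length xs                             ≤⟨ expandedForest-height≤ r r′ ⟩
    sum (map (length ∘ block) ys)         ≤⟨ blocks-length ys ⟩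
    n * length ys + sum (map w ys) * M    ≤⟨ +-mono-≤ (*-monoʳ-≤ n (unique⇒length≤n ys-unique))
                                                      (*-monoˡ-≤ M (weight≤t ys ys-vertical)) ⟩
    n * n + t * M                         ≡⟨ trans (+-comm (n * n) (t * M)) (cong (_+ n * n) (*-comm t M)) ⟩
    M * t + n * n                         ∎
    where
    open ≤-Reasoning
    ys = proj₁ (rootPath-exists elimForest-isForest (enumerateFin n) (owner v))
    r′ = proj₂ (rootPath-exists elimForest-isForest (enumerateFin n) (owner v))
    ys-unique = rootPath-unique elimForest-isForest r′
    ys-vertical : VerticalPath F ys
    ys-vertical = ys-unique , AllPairs.map (Data.Sum.map elim⇒anc elim⇒anc) (ancestors-pairwiseComparable (rootPath-anc r′))

module DecompositionFromDFSTree {n} (T : Graph (Fin n)) (w : Fin n → ℕ) (M : ℕ)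
                                (class-nonempty : ∀ x → 0 < w x * M)
                                {FG : RootedForest (GMV w M)} (td : IsTDDecomp (GM T w M) FG) where

  open BlowUp T w M

  enumerateGV : Enumeration GV
  enumerateGV = concatMap class (allFin n) , λ (x , i) → ∈-concatMap⁺ class (lose (∈-allFin x) (∈-tabulate⁺ i))

  class-comparable : ∀ x → AllPairs (Comparable FG) (class x)
  class-comparable x = AllPairs.tabulate⁺ λ i≢j → proj₂ td _ _ (sameClass-adjacent refl (i≢j ∘ vertex-injective))

  deepestInClass : ∀ x → ∃ λ i → ∀ j → Anc FG (vertex x j) (vertex x i)
  deepestInClass x with deepest (class x) (∈-tabulate⁺ (fromℕ< (class-nonempty x))) (class-comparable x)
  ... | d , d∈ , below with ∈-tabulate⁻ d∈
  ...   | i , refl = i , λ j → below (∈-tabulate⁺ j)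

  bottom : Fin n → GV
  bottom x = vertex x (proj₁ (deepestInClass x))

  preimage : GV → Maybe (Fin n)
  preimage (z , i) with bottom z ≟ (z , i)
  ... | yes _ = just z
  ... | no _  = nothing

  preimage-bottom : ∀ x → preimage (bottom x) ≡ just x
  preimage-bottom x with bottom x ≟ bottom x
  ... | yes _ = refl
  ... | no b≢b = ⊥-elim (b≢b refl)

  bottom-preimage : ∀ {u x} → preimage u ≡ just x → bottom x ≡ u
  bottom-preimage {z , i} e with bottom z ≟ (z , i)
  bottom-preimage refl | yes b≡u = b≡u

  open RestrictedForest (proj₁ td) enumerateGV bottom preimage preimage-bottom bottom-preimage public

  restrictedForest-isTDDecomp : IsTDDecomp T restrictedForest
  restrictedForest-isTDDecomp = restrictedForest-isForest , λ x y x~y →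
    Data.Sum.map embed-anc⇒anc embed-anc⇒anc (proj₂ td (bottom x) (bottom y) (inj₂ x~y))

  ∈-classes⁻ : ∀ {u} xs → u ∈ concatMap class xs → proj₁ u ∈ xs × Anc FG u (bottom (proj₁ u))
  ∈-classes⁻ xs u∈ with find (∈-concatMap⁻ class u∈)
  ... | x , x∈ , u∈class with ∈-tabulate⁻ u∈class
  ...   | j , refl = x∈ , proj₂ (deepestInClass x) j

  classes-unique : ∀ {xs} → Unique xs → Unique (concatMap class xs)
  classes-unique [] = []
  classes-unique {x ∷ xs} (x∉xs ∷ uniq) =
    Unique.++⁺ (Unique.tabulate⁺ vertex-injective) (classes-unique uniq) λ (u∈x , u∈xs) →
      let j , u≡ = ∈-tabulate⁻ u∈x in
      All.lookup x∉xs (subst (_∈ xs) (cong proj₁ u≡) (proj₁ (∈-classes⁻ xs u∈xs))) refl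

  length-classes : ∀ xs → length (concatMap class xs) ≡ sum (map w xs) * M
  length-classes [] = refl
  length-classes (x ∷ xs) = begin
    length (class x ++ concatMap class xs)          ≡⟨ length-++ (class x) ⟩
    length (class x) + length (concatMap class xs)  ≡⟨ cong₂ _+_ (length-tabulate (vertex x)) (length-classes xs) ⟩
    w x * M + sum (map w xs) * M                    ≡⟨ *-distribʳ-+ M (w x) (sum (map w xs)) ⟨
    (w x + sum (map w xs)) * M                      ∎
    where open ≡-Reasoning

  -- The classes of a vertical path all lie above the bottom vertex of its deepest member.
  weight*M≤height : ∀ h → HeightAtMost FG h → ∀ xs → VerticalPath restrictedForest xs → sum (map w xs) * M ≤ h
  weight*M≤height h height [] _ = z≤n
  weight*M≤height h height (a ∷ xs) (uniq , comparable) with deepest (a ∷ xs) (here refl) comparable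
  ... | d , _ , below-d = begin
    sum (map w (a ∷ xs)) * M              ≡⟨ length-classes (a ∷ xs) ⟨
    length (concatMap class (a ∷ xs))    ≤⟨ unique-⊆⇒length≤ (classes-unique uniq) classes⊆ ⟩
    length ys                            ≤⟨ height (bottom d) ys r ⟩
    h                                    ∎
    where
    open ≤-Reasoning
    ys = proj₁ (rootPath-exists (proj₁ td) enumerateGV (bottom d))
    r = proj₂ (rootPath-exists (proj₁ td) enumerateGV (bottom d))
    classes⊆ : concatMap class (a ∷ xs) ⊆ ys
    classes⊆ u∈ = let x∈ , u≼x = ∈-classes⁻ (a ∷ xs) u∈ in
                  anc⇒∈rootPath r (anc-trans u≼x (anc-embed (below-d x∈)))

m*n≤o⇒m≤o/n : ∀ m n o .{{_ : NonZero n}} → m * n ≤ o → m ≤ o / n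
m*n≤o⇒m≤o/n m n o m*n≤o = subst (_≤ o / n) (m*n/n≡m m n) (/-monoˡ-≤ n m*n≤o)

M*td≤height : ∀ {n} (T : Graph (Fin n)) (w : Fin n → ℕ) (M : ℕ) {t h} → (∀ x → 1 ≤ w x) → 1 ≤ M →
              IsTd T w t → ∀ {FG} → IsTDDecomp (GM T w M) FG → HeightAtMost FG h → M * t ≤ h
M*td≤height T w M {t} {h} w-pos M-pos (_ , td-minimal) td height = begin
  M * t        ≤⟨ *-monoʳ-≤ M t≤h/M ⟩
  M * (h / M)  ≡⟨ *-comm M (h / M) ⟩
  h / M * M    ≤⟨ m/n*n≤m h M ⟩
  h            ∎
  where
  open ≤-Reasoning
  instance
    M-nonZero : NonZero M
    M-nonZero = >-nonZero M-pos
  open DecompositionFromDFSTree T w M (λ x → *-mono-≤ (w-pos x) M-pos) td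
  t≤h/M : t ≤ h / M
  t≤h/M = td-minimal (h / M) restrictedForest restrictedForest-isTDDecomp
            λ xs vertical → m*n≤o⇒m≤o/n _ M h (weight*M≤height h height xs vertical)

dfsTree-height≤M*t+n*n : ∀ {n} (T : Graph (Fin n)) (w : Fin n → ℕ) (M : ℕ) {t} → IsTree T → (∀ x → 1 ≤ w x) →
                         n ≤ M → ∀ {F} → IsTDDecomp T F → WeightBound F w t →
                         ∃ λ FG → IsDFSTree (GM T w M) FG × HeightAtMost FG (M * t + n * n)
dfsTree-height≤M*t+n*n T w M {t} tree w-pos n≤M td weight≤t = expandedForest , isDFSTree , dfsTree-height≤ t weight≤t
  where open DFSTreeFromDecomposition T tree td w w-pos M n≤M

lemma11 : ∀ (n : ℕ) (T : Graph (Fin n)) → IsTree T →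
          (w : Fin n → ℕ) → (∀ x → 1 ≤ w x) →
          (M : ℕ) → 1 ≤ M → n ≤ M →
          ∀ (t h : ℕ) → IsTd T w t → IsMinHLT (GM T w M) h →
          (M * t ≤ h) × (h ≤ M * t + n * n)
lemma11 n T tree w w-pos M M-pos n≤M t h isTd ((_ , (isF , _ , _ , comparable) , height) , minimal) =
  let _ , td , weight≤t = proj₁ isTd
      FG , dfs , height′ = dfsTree-height≤M*t+n*n T w M tree w-pos n≤M td weight≤t
  in M*td≤height T w M w-pos M-pos isTd (isF , comparable) height ,
     minimal (M * t + n * n) FG dfs height′
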